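{- Let $H$ be a hypergraph, $k$ a positive integer, $S\subseteq V(H)$, and let $X$ be a balanced separator for $S$ with $\rho(X)\le k$. Then: (1) if $\rho(S)\ge3k+1$, then $H\setminus X$ has at least two connected components; (2) if moreover $\rho(S)\ge 6k+1$ and $V'$ is a connected component of $H\setminus X$, then $\rho(V'\cup X)<\rho(V(H))$.
   Context: A hypergraph $H$ has a finite vertex set $V(H)$ and a family $E(H)$ of subsets (hyperedges), with no isolated vertices. For $U\subseteq V(H)$, $H[U]$ has vertex set $U$ and hyperedges $\{e\cap U:e\in E(H), e\cap U\ne\emptyset\}$, $H\setminus U=H[V(H)\setminus U]$, and connected components are defined via paths (vertex sequences with consecutive vertices in a common hyperedge). $\rho(U)$ is the smallest number of hyperedges of $H$ whose union contains $U$. $X$ is a balanced separator for $S$ if every connected component $V'$ of $H\setminus X$ satisfies $\rho(V'\cap S)<\frac23\rho(S)$. -}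

module Defs where

open import Data.Nat using (ℕ; _⊔_; _⊓_)
open import Data.Fin using (Fin)
open import Data.Fin.Subset using (Subset; _∈_; _∉_; _⊆_; ⋃; _∩_; _∪_; ⊤)
open import Data.Fin.Subset.Properties using (_⊆?_)
open import Data.List using (List; []; _∷_; _++_; map; length; filter; foldr)
open import Data.List.Relation.Unary.Any using (Any)
open import Data.Product using (_×_; ∃; Σ)
open import Relation.Nullary using (¬_)

record Hypergraph : Set where
  field
    n          : ℕ
    edges      : List (Subset n)
    noIsolated : (v : Fin n) → Any (v ∈_) edges
open Hypergraph public

subfamilies : {A : Set} → List A → List (List A)
subfamilies []       = [] ∷ []
subfamilies (x ∷ xs) = subfamilies xs ++ map (x ∷_) (subfamilies xs)

-- ρ(U): least number of hyperedges of H whose union contains U.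
-- (default value length (edges H) is never attained by an uncoverable U
--  when U ⊆ V(H), since there are no isolated vertices)
ρ : (H : Hypergraph) → Subset (n H) → ℕ
ρ H U = foldr _⊓_ (length (edges H))
          (map length (filter (λ F → U ⊆? ⋃ F) (subfamilies (edges H))))

Adj : (H : Hypergraph) → Subset (n H) → Fin (n H) → Fin (n H) → Set
Adj H X u v = u ∉ X × v ∉ X × Any (λ e → u ∈ e × v ∈ e) (edges H)

data Reach (H : Hypergraph) (X : Subset (n H)) (u : Fin (n H)) : Fin (n H) → Set where
  here : u ∉ X → Reach H X u u
  step : ∀ {v w} → Reach H X u v → Adj H X v w → Reach H X u w

IsComponent : (H : Hypergraph) → Subset (n H) → Subset (n H) → Set
IsComponent H X C =
  ∃ (λ v → v ∈ C)
  × (∀ u → u ∈ C → u ∉ X)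
  × (∀ u v → u ∈ C → v ∈ C → Reach H X u v)
  × (∀ u v → u ∈ C → Adj H X u v → v ∈ C)

BalancedSeparator : (H : Hypergraph) → Subset (n H) → Subset (n H) → Set
BalancedSeparator H S X =
  ∀ C → IsComponent H X C → 3 Data.Nat.* ρ H (C ∩ S) Data.Nat.< 2 Data.Nat.* ρ H S

-- ρ(U) is the size of an optimal cover of U by hyperedges, so ρ is monotone and
-- subadditive, and it is superadditive on two vertex sets that no hyperedge meets
-- simultaneously, such as a component C of H ∖ X and the rest ∁ (C ∪ X). Subadditivity
-- turns the balance condition 3 ρ(C ∩ S) < 2 ρ(S) into ρ(S) < 3 (k + ρ(R)) whenever
-- S ⊆ (C ∩ S) ∪ X ∪ R. For (1), R = ∅ shows that S ⊈ X ∪ C₁ for the component C₁ of a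
-- vertex of S ∖ X, and a vertex of S outside X ∪ C₁ lies in a second component. For (2),
-- R = ∁ (C ∪ X) gives ρ(R) > k, whence ρ(C ∪ X) ≤ ρ(C) + k < ρ(C) + ρ(R) ≤ ρ(V(H)).
{-# OPTIONS --safe #-}
module Submission where

open import Defs
open import Data.Nat using (ℕ; suc; _≤_; _<_; _*_; _+_; _⊓_; z≤n; s≤s)
open import Data.Nat.Properties
open import Data.Nat.Tactic.RingSolver using (solve-∀)
open import Data.Fin using (Fin; zero; suc)
open import Data.Fin.Properties using (any?)
open import Data.Fin.Subset using (Subset; _∪_; _∩_; _─_; ∁; ⊤; ⁅_⁆; _∈_; _∉_; _⊆_; _⊃_; ⋃; ∣_∣; inside; outside)
  renaming (⊥ to ∅)
open import Data.Fin.Subset.Properties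
  using (_∈?_; _⊆?_; ∈⊤; ∉⊥; ∣⊤∣≡n; ∣⊥∣≡0; x∈p∩q⁺; x∈p∪q⁺; x∈p∪q⁻; p⊆p∪q; x∈⁅x⁆; x∈⁅y⁆⇒x≡y;
         x∈p∧x∉q⇒x∈p─q; x∉p⇒x∈∁p; x∈∁p⇒x∉p)
open import Data.Fin.Subset.Induction using (⊃-wellFounded)
open import Data.List using (List; []; _∷_; length; map; filter; foldr; lookup)
open import Data.List.Relation.Unary.Any as Any using (Any; here; there)
open import Data.List.Relation.Unary.Any.Properties using (lookup-index)
import Data.List.Membership.Propositional as List
open import Data.List.Membership.Propositional using (lose)
open import Data.List.Membership.Propositional.Properties
  using (∈-++⁺ˡ; ∈-++⁺ʳ; ∈-++⁻; ∈-map⁺; ∈-map⁻; ∈-filter⁺; ∈-filter⁻; ∈-lookup)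
open import Data.Vec using (tabulate; []; _∷_; here; there)
open import Data.Vec.Properties using (lookup∘tabulate; lookup⇒[]=; []=⇒lookup)
open import Data.Product using (_×_; Σ; ∃; _,_)
open import Data.Sum using (_⊎_; inj₁; inj₂; [_,_])
open import Data.Empty using (⊥; ⊥-elim)
open import Function using (_∘_)
open import Induction.WellFounded using (Acc; acc)
open import Relation.Nullary using (Dec; yes; no; ¬_; ¬?; does; contradiction)
open import Relation.Nullary.Decidable using (_×-dec_; decidable-stable; dec-true)
open import Relation.Unary using (Pred; Decidable)
open import Relation.Binary.PropositionalEquality using (_≡_; _≢_; refl; sym; trans; cong; cong₂; subst)

private
  variable
    m : ℕ

∣p∪q∣≤∣p∣+∣q∣ : (p q : Subset m) → ∣ p ∪ q ∣ ≤ ∣ p ∣ + ∣ q ∣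
∣p∪q∣≤∣p∣+∣q∣ []            []            = z≤n
∣p∪q∣≤∣p∣+∣q∣ (outside ∷ p) (outside ∷ q) = ∣p∪q∣≤∣p∣+∣q∣ p q
∣p∪q∣≤∣p∣+∣q∣ (outside ∷ p) (inside  ∷ q) =
  ≤-trans (s≤s (∣p∪q∣≤∣p∣+∣q∣ p q)) (≤-reflexive (sym (+-suc ∣ p ∣ ∣ q ∣)))
∣p∪q∣≤∣p∣+∣q∣ (inside  ∷ p) (outside ∷ q) = s≤s (∣p∪q∣≤∣p∣+∣q∣ p q)
∣p∪q∣≤∣p∣+∣q∣ (inside  ∷ p) (inside  ∷ q) =
  s≤s (≤-trans (∣p∪q∣≤∣p∣+∣q∣ p q) (+-monoʳ-≤ ∣ p ∣ (n≤1+n ∣ q ∣)))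

∣p∩q∣+∣p─q∣≡∣p∣ : (p q : Subset m) → ∣ p ∩ q ∣ + ∣ p ─ q ∣ ≡ ∣ p ∣
∣p∩q∣+∣p─q∣≡∣p∣ []            []            = refl
∣p∩q∣+∣p─q∣≡∣p∣ (outside ∷ p) (outside ∷ q) = ∣p∩q∣+∣p─q∣≡∣p∣ p q
∣p∩q∣+∣p─q∣≡∣p∣ (outside ∷ p) (inside  ∷ q) = ∣p∩q∣+∣p─q∣≡∣p∣ p q
∣p∩q∣+∣p─q∣≡∣p∣ (inside  ∷ p) (outside ∷ q) =
  trans (+-suc ∣ p ∩ q ∣ ∣ p ─ q ∣) (cong suc (∣p∩q∣+∣p─q∣≡∣p∣ p q))
∣p∩q∣+∣p─q∣≡∣p∣ (inside  ∷ p) (inside  ∷ q) = cong suc (∣p∩q∣+∣p─q∣≡∣p∣ p q)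

⊆-or-escapes : (p q : Subset m) → p ⊆ q ⊎ ∃ λ x → x ∈ p × x ∉ q
⊆-or-escapes p q with any? (λ x → x ∈? p ×-dec ¬? (x ∈? q))
... | yes escape  = inj₂ escape
... | no noEscape = inj₁ λ {x} x∈p → decidable-stable (x ∈? q) (λ x∉q → noEscape (x , x∈p , x∉q))

module _ {a} {A : Set a} {P : Pred A a} (P? : Decidable P) where

  ∈-tabulate⁺ : ∀ {m} {f : Fin m → A} {i} → P (f i) → i ∈ tabulate (does ∘ P? ∘ f)
  ∈-tabulate⁺ {f = f} {i} p =
    lookup⇒[]= i _ (trans (lookup∘tabulate (does ∘ P? ∘ f) i) (dec-true (P? (f i)) p))

  ∈-tabulate⁻ : ∀ {m} {f : Fin m → A} {i} → i ∈ tabulate (does ∘ P? ∘ f) → P (f i)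
  ∈-tabulate⁻ {f = f} {i} i∈ with P? (f i) | trans (sym (lookup∘tabulate (does ∘ P? ∘ f) i)) ([]=⇒lookup i∈)
  ... | yes p | _  = p
  ... | no _  | ()

foldr-⊓-≤ : ∀ d {xs : List ℕ} {x} → x List.∈ xs → foldr _⊓_ d xs ≤ x
foldr-⊓-≤ d {y ∷ _} (here refl) = m⊓n≤m y _
foldr-⊓-≤ d {y ∷ _} (there x∈xs) = ≤-trans (m⊓n≤n y _) (foldr-⊓-≤ d x∈xs)

foldr-⊓-sel : ∀ d (xs : List ℕ) → foldr _⊓_ d xs ≡ d ⊎ foldr _⊓_ d xs List.∈ xs
foldr-⊓-sel d []       = inj₁ refl
foldr-⊓-sel d (y ∷ xs) with ⊓-sel y (foldr _⊓_ d xs)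
... | inj₁ ≡y = inj₂ (here ≡y)
... | inj₂ ≡rest with foldr-⊓-sel d xs
...   | inj₁ ≡d   = inj₁ (trans ≡rest ≡d)
...   | inj₂ ∈xs  = inj₂ (there (subst (List._∈ xs) (sym ≡rest) ∈xs))

∈⋃⁺ : ∀ {x : Fin m} (ps : List (Subset m)) → Any (x ∈_) ps → x ∈ ⋃ ps
∈⋃⁺ (p ∷ ps) (here x∈p)  = x∈p∪q⁺ (inj₁ x∈p)
∈⋃⁺ (p ∷ ps) (there x∈⋃) = x∈p∪q⁺ {p = p} (inj₂ (∈⋃⁺ ps x∈⋃))

∈⋃⁻ : ∀ {x : Fin m} (ps : List (Subset m)) → x ∈ ⋃ ps → Any (x ∈_) ps
∈⋃⁻ []       x∈⋃ = contradiction x∈⋃ ∉⊥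
∈⋃⁻ (p ∷ ps) x∈⋃ with x∈p∪q⁻ p (⋃ ps) x∈⋃
... | inj₁ x∈p  = here x∈p
... | inj₂ x∈ps = there (∈⋃⁻ ps x∈ps)

module _ {A : Set} where

  select : (xs : List A) → Subset (length xs) → List A
  select []       []            = []
  select (x ∷ xs) (inside  ∷ p) = x ∷ select xs p
  select (x ∷ xs) (outside ∷ p) = select xs p

  length-select : (xs : List A) (p : Subset (length xs)) → length (select xs p) ≡ ∣ p ∣
  length-select []       []            = refl
  length-select (x ∷ xs) (inside  ∷ p) = cong suc (length-select xs p)
  length-select (x ∷ xs) (outside ∷ p) = length-select xs p

  select∈subfamilies : (xs : List A) (p : Subset (length xs)) → select xs p List.∈ subfamilies xs
  select∈subfamilies []       []            = here refl
  select∈subfamilies (x ∷ xs) (inside  ∷ p) =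
    ∈-++⁺ʳ (subfamilies xs) (∈-map⁺ (x ∷_) (select∈subfamilies xs p))
  select∈subfamilies (x ∷ xs) (outside ∷ p) = ∈-++⁺ˡ (select∈subfamilies xs p)

  subfamily⇒select : (xs : List A) {F : List A} → F List.∈ subfamilies xs →
                     ∃ λ p → F ≡ select xs p
  subfamily⇒select []       (here refl) = [] , refl
  subfamily⇒select (x ∷ xs) F∈ with ∈-++⁻ (subfamilies xs) F∈
  ... | inj₁ F∈xs = let p , F≡ = subfamily⇒select xs F∈xs in outside ∷ p , F≡
  ... | inj₂ F∈x∷ with ∈-map⁻ (x ∷_) F∈x∷
  ...   | G , G∈xs , refl = let p , G≡ = subfamily⇒select xs G∈xs in inside ∷ p , cong (x ∷_) G≡

  module _ {P : A → Set} where

    Any-select⁺ : (xs : List A) {p : Subset (length xs)} {i : Fin (length xs)} →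
                  i ∈ p → P (lookup xs i) → Any P (select xs p)
    Any-select⁺ (x ∷ xs) {inside  ∷ p} {zero}  _            px = here px
    Any-select⁺ (x ∷ xs) {inside  ∷ p} {suc i} (there i∈p) px = there (Any-select⁺ xs i∈p px)
    Any-select⁺ (x ∷ xs) {outside ∷ p} {suc i} (there i∈p) px = Any-select⁺ xs i∈p px

    Any-select⁻ : (xs : List A) (p : Subset (length xs)) →
                  Any P (select xs p) → ∃ λ i → i ∈ p × P (lookup xs i)
    Any-select⁻ []       []            ()
    Any-select⁻ (x ∷ xs) (inside  ∷ p) (here px)  = zero , here , px
    Any-select⁻ (x ∷ xs) (inside  ∷ p) (there pp) =
      let i , i∈p , pi = Any-select⁻ xs p pp in suc i , there i∈p , pi
    Any-select⁻ (x ∷ xs) (outside ∷ p) pp         =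
      let i , i∈p , pi = Any-select⁻ xs p pp in suc i , there i∈p , pi

module Covers (H : Hypergraph) where

  V : Set
  V = Subset (n H)

  edge : Fin (length (edges H)) → V
  edge = lookup (edges H)

  infix 4 _covers_

  _covers_ : Subset (length (edges H)) → V → Set
  J covers U = ∀ {v} → v ∈ U → ∃ λ i → i ∈ J × v ∈ edge i

  ρ≤∣cover∣ : ∀ {U J} → J covers U → ρ H U ≤ ∣ J ∣
  ρ≤∣cover∣ {U} {J} cov = subst (ρ H U ≤_) (length-select (edges H) J)
    (foldr-⊓-≤ _ (∈-map⁺ length (∈-filter⁺ (λ F → U ⊆? ⋃ F) (select∈subfamilies (edges H) J)
      λ v∈U → let i , i∈J , v∈i = cov v∈U in ∈⋃⁺ _ (Any-select⁺ (edges H) i∈J v∈i))))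

  ρ-∅ : ρ H ∅ ≡ 0
  ρ-∅ = n≤0⇒n≡0 (subst (ρ H ∅ ≤_) (∣⊥∣≡0 (length (edges H)))
                  (ρ≤∣cover∣ {J = ∅} λ v∈∅ → contradiction v∈∅ ∉⊥))

  -- The default value of the minimum in ρ is attained by the cover of all hyperedges.
  optimalCover : ∀ U → ∃ λ J → J covers U × ∣ J ∣ ≡ ρ H U
  optimalCover U with foldr-⊓-sel (length (edges H))
                        (map length (filter (λ F → U ⊆? ⋃ F) (subfamilies (edges H))))
  ... | inj₁ ρ≡all = ⊤ , (λ {v} _ → let v∈e = noIsolated H v in Any.index v∈e , ∈⊤ , lookup-index v∈e)
                       , trans (∣⊤∣≡n _) (sym ρ≡all)
  ... | inj₂ ρ∈ with ∈-map⁻ length ρ∈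
  ...   | F , F∈ , ρ≡ with ∈-filter⁻ (λ F → U ⊆? ⋃ F) F∈
  ...     | F∈sub , U⊆F with subfamily⇒select (edges H) F∈sub
  ...       | J , refl = J , (λ v∈U → Any-select⁻ (edges H) J (∈⋃⁻ _ (U⊆F v∈U)))
                           , trans (sym (length-select (edges H) J)) (sym ρ≡)

  ρ-mono : ∀ {U W} → U ⊆ W → ρ H U ≤ ρ H W
  ρ-mono {W = W} U⊆W with optimalCover W
  ... | J , cov , ∣J∣≡ = subst (_ ≤_) ∣J∣≡ (ρ≤∣cover∣ (cov ∘ U⊆W))

  ρ-subadditive : ∀ U W → ρ H (U ∪ W) ≤ ρ H U + ρ H W
  ρ-subadditive U W with optimalCover U | optimalCover W
  ... | J , covU , ∣J∣≡ | K , covW , ∣K∣≡ = begin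
    ρ H (U ∪ W)         ≤⟨ ρ≤∣cover∣ cov ⟩
    ∣ J ∪ K ∣           ≤⟨ ∣p∪q∣≤∣p∣+∣q∣ J K ⟩
    ∣ J ∣ + ∣ K ∣       ≡⟨ cong₂ _+_ ∣J∣≡ ∣K∣≡ ⟩
    ρ H U + ρ H W       ∎
    where
    open ≤-Reasoning
    cov : (J ∪ K) covers (U ∪ W)
    cov v∈U∪W with x∈p∪q⁻ U W v∈U∪W
    ... | inj₁ v∈U = let i , i∈J , v∈i = covU v∈U in i , x∈p∪q⁺ (inj₁ i∈J) , v∈i
    ... | inj₂ v∈W = let i , i∈K , v∈i = covW v∈W in i , x∈p∪q⁺ {p = J} (inj₂ i∈K) , v∈i

  NoEdgeMeetsBoth : V → V → Set
  NoEdgeMeetsBoth A B = ∀ {i a b} → a ∈ A → b ∈ B → a ∈ edge i → b ∈ edge i → ⊥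

  -- An optimal cover of A ∪ B splits into the hyperedges meeting A and the others, which cover B.
  ρ-superadditive : ∀ {A B} → NoEdgeMeetsBoth A B → ρ H A + ρ H B ≤ ρ H (A ∪ B)
  ρ-superadditive {A} {B} separated with optimalCover (A ∪ B)
  ... | J , cov , ∣J∣≡ = begin
    ρ H A + ρ H B               ≤⟨ +-mono-≤ (ρ≤∣cover∣ covA) (ρ≤∣cover∣ covB) ⟩
    ∣ J ∩ M ∣ + ∣ J ─ M ∣       ≡⟨ ∣p∩q∣+∣p─q∣≡∣p∣ J M ⟩
    ∣ J ∣                       ≡⟨ ∣J∣≡ ⟩
    ρ H (A ∪ B)                 ∎
    where
    open ≤-Reasoning
    meetsA? : Decidable (λ (e : V) → ∃ λ a → a ∈ A × a ∈ e)
    meetsA? e = any? (λ a → a ∈? A ×-dec a ∈? e)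
    M : Subset (length (edges H))
    M = tabulate (does ∘ meetsA? ∘ edge)
    covA : (J ∩ M) covers A
    covA a∈A = let i , i∈J , a∈i = cov (x∈p∪q⁺ (inj₁ a∈A))
               in i , x∈p∩q⁺ (i∈J , ∈-tabulate⁺ meetsA? (_ , a∈A , a∈i)) , a∈i
    covB : (J ─ M) covers B
    covB b∈B = let i , i∈J , b∈i = cov (x∈p∪q⁺ {p = A} (inj₂ b∈B))
               in i , x∈p∧x∉q⇒x∈p─q i∈J (λ i∈M → let _ , a∈A , a∈i = ∈-tabulate⁻ meetsA? i∈M
                                                  in separated a∈A b∈B a∈i b∈i) , b∈i

module Components (H : Hypergraph) (X : Subset (n H)) where

  open Covers H using (V; edge; NoEdgeMeetsBoth)

  Reach-∉ : ∀ {u w} → Reach H X u w → w ∉ X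
  Reach-∉ (here w∉X)               = w∉X
  Reach-∉ (step _ (_ , w∉X , _)) = w∉X

  Adj-sym : ∀ {u w} → Adj H X u w → Adj H X w u
  Adj-sym (u∉X , w∉X , e) = w∉X , u∉X , Any.map (λ (u∈ , w∈) → w∈ , u∈) e

  Reach-trans : ∀ {u v w} → Reach H X u v → Reach H X v w → Reach H X u w
  Reach-trans p (here _)   = p
  Reach-trans p (step q a) = step (Reach-trans p q) a

  Reach-sym : ∀ {u w} → Reach H X u w → Reach H X w u
  Reach-sym (here u∉X)              = here u∉X
  Reach-sym (step p a@(_ , w∉X , _)) = Reach-trans (step (here w∉X) (Adj-sym a)) (Reach-sym p)

  Adj? : ∀ u w → Dec (Adj H X u w)
  Adj? u w = ¬? (u ∈? X) ×-dec ¬? (w ∈? X)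
             ×-dec Any.any? (λ e → u ∈? e ×-dec w ∈? e) (edges H)

  component-containing : ∀ {v} → v ∉ X → Σ V λ C → IsComponent H X C × v ∈ C
  component-containing {v} v∉X = grow ⁅ v ⁆ (⊃-wellFounded _) (x∈⁅x⁆ v) reach⁅v⁆
    where
    reach⁅v⁆ : ∀ {u} → u ∈ ⁅ v ⁆ → Reach H X v u
    reach⁅v⁆ u∈ rewrite x∈⁅y⁆⇒x≡y _ u∈ = here v∉X

    grow : ∀ R → Acc _⊃_ R → v ∈ R → (∀ {u} → u ∈ R → Reach H X v u) →
           Σ V λ C → IsComponent H X C × v ∈ C
    grow R (acc smaller) v∈R reach
      with any? (λ u → any? (λ w → u ∈? R ×-dec ¬? (w ∈? R) ×-dec Adj? u w))
    ... | yes (u , w , u∈R , w∉R , adj) =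
      grow (R ∪ ⁅ w ⁆) (smaller R⊂R∪w) (p⊆p∪q ⁅ w ⁆ v∈R) reach′
      where
      R⊂R∪w : (R ∪ ⁅ w ⁆) ⊃ R
      R⊂R∪w = p⊆p∪q ⁅ w ⁆ , w , x∈p∪q⁺ {p = R} (inj₂ (x∈⁅x⁆ w)) , w∉R
      reach′ : ∀ {x} → x ∈ R ∪ ⁅ w ⁆ → Reach H X v x
      reach′ x∈ with x∈p∪q⁻ R ⁅ w ⁆ x∈
      ... | inj₁ x∈R = reach x∈R
      ... | inj₂ x∈w rewrite x∈⁅y⁆⇒x≡y _ x∈w = step (reach u∈R) adj
    ... | no noExit = R , component , v∈R
      where
      closed : ∀ u w → u ∈ R → Adj H X u w → w ∈ R
      closed u w u∈R adj =
        decidable-stable (w ∈? R) (λ w∉R → noExit (u , w , u∈R , w∉R , adj))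
      component : IsComponent H X R
      component = (v , v∈R)
                , (λ u u∈R → Reach-∉ (reach u∈R))
                , (λ u w u∈R w∈R → Reach-trans (Reach-sym (reach u∈R)) (reach w∈R))
                , closed

  component-separated : ∀ {C} → IsComponent H X C → NoEdgeMeetsBoth C (∁ (C ∪ X))
  component-separated {C} (_ , C∌X , _ , closed) {i} c∈C r∈rest c∈i r∈i =
    r∉C∪X (x∈p∪q⁺ (inj₁ (closed _ _ c∈C adj)))
    where
    r∉C∪X : _ ∉ C ∪ X
    r∉C∪X = x∈∁p⇒x∉p r∈rest
    adj : Adj H X _ _
    adj = C∌X _ c∈C , (λ r∈X → r∉C∪X (x∈p∪q⁺ {p = C} (inj₂ r∈X)))
        , lose (∈-lookup {xs = edges H} i) (c∈i , r∈i)

m+1≤n⇒n≰m : ∀ {m n} → m + 1 ≤ n → ¬ n ≤ m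
m+1≤n⇒n≰m {m} {n} m+1≤n n≤m = ≤⇒≯ m+1≤n (subst (n <_) (+-comm 1 m) (s≤s n≤m))

m≤n+o∧3n<2m⇒m<3o : ∀ {m n o} → m ≤ n + o → 3 * n < 2 * m → m < 3 * o
m≤n+o∧3n<2m⇒m<3o {m} {n} {o} m≤n+o 3n<2m = +-cancelˡ-< (2 * m) m (3 * o) (begin-strict
  2 * m + m      ≡⟨ +-comm (2 * m) m ⟩
  3 * m          ≤⟨ *-monoʳ-≤ 3 m≤n+o ⟩
  3 * (n + o)    ≡⟨ *-distribˡ-+ 3 n o ⟩
  3 * n + 3 * o  <⟨ +-monoˡ-< (3 * o) 3n<2m ⟩
  2 * m + 3 * o  ∎)
  where open ≤-Reasoning

3[k+k]≡6k : ∀ k → 3 * (k + k) ≡ 6 * k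
3[k+k]≡6k = solve-∀

p⊆[q∩p]∪[r∪∁[q∪r]] : (p q r : Subset m) → p ⊆ (q ∩ p) ∪ (r ∪ ∁ (q ∪ r))
p⊆[q∩p]∪[r∪∁[q∪r]] p q r {x} x∈p with x ∈? q | x ∈? r
... | yes x∈q | _       = x∈p∪q⁺ (inj₁ (x∈p∩q⁺ (x∈q , x∈p)))
... | no _    | yes x∈r = x∈p∪q⁺ {p = q ∩ p} (inj₂ (x∈p∪q⁺ (inj₁ x∈r)))
... | no x∉q  | no x∉r  = x∈p∪q⁺ {p = q ∩ p} (inj₂ (x∈p∪q⁺ {p = r} (inj₂ (x∉p⇒x∈∁p
    λ x∈q∪r → [ x∉q , x∉r ] (x∈p∪q⁻ q r x∈q∪r)))))

module _ (H : Hypergraph) (k : ℕ) (S X : Subset (n H))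
         (balanced : BalancedSeparator H S X) (ρX≤k : ρ H X ≤ k) where

  open Covers H
  open Components H X

  ρS<3[k+ρR] : ∀ {C R} → IsComponent H X C → S ⊆ (C ∩ S) ∪ (X ∪ R) → ρ H S < 3 * (k + ρ H R)
  ρS<3[k+ρR] {C} {R} isC S⊆ = m≤n+o∧3n<2m⇒m<3o {n = ρ H (C ∩ S)} (begin
    ρ H S                         ≤⟨ ρ-mono S⊆ ⟩
    ρ H ((C ∩ S) ∪ (X ∪ R))       ≤⟨ ρ-subadditive (C ∩ S) (X ∪ R) ⟩
    ρ H (C ∩ S) + ρ H (X ∪ R)     ≤⟨ +-monoʳ-≤ (ρ H (C ∩ S)) (ρ-subadditive X R) ⟩
    ρ H (C ∩ S) + (ρ H X + ρ H R) ≤⟨ +-monoʳ-≤ (ρ H (C ∩ S)) (+-monoˡ-≤ (ρ H R) ρX≤k) ⟩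
    ρ H (C ∩ S) + (k + ρ H R)     ∎) (balanced C isC)
    where open ≤-Reasoning

  two-components : 3 * k + 1 ≤ ρ H S →
    Σ V λ C₁ → Σ V λ C₂ → IsComponent H X C₁ × IsComponent H X C₂ × C₁ ≢ C₂
  two-components 3k+1≤ρS with ⊆-or-escapes S X
  ... | inj₁ S⊆X =
    ⊥-elim (m+1≤n⇒n≰m 3k+1≤ρS (≤-trans (≤-trans (ρ-mono S⊆X) ρX≤k) (m≤n*m k 3)))
  ... | inj₂ (v , _ , v∉X) with component-containing v∉X
  ...   | C₁ , isC₁ , _ with ⊆-or-escapes S ((C₁ ∩ S) ∪ (X ∪ ∅))
  ...     | inj₁ S⊆ =
    ⊥-elim (m+1≤n⇒n≰m 3k+1≤ρS (<⇒≤ (subst (ρ H S <_) 3[k+ρ∅]≡3k (ρS<3[k+ρR] isC₁ S⊆))))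
    where
    3[k+ρ∅]≡3k : 3 * (k + ρ H ∅) ≡ 3 * k
    3[k+ρ∅]≡3k = trans (cong (λ r → 3 * (k + r)) ρ-∅) (cong (3 *_) (+-identityʳ k))
  ...     | inj₂ (w , w∈S , w∉)
          with component-containing (w∉ ∘ x∈p∪q⁺ {p = C₁ ∩ S} ∘ inj₂ ∘ x∈p∪q⁺ ∘ inj₁)
  ...       | C₂ , isC₂ , w∈C₂ =
    C₁ , C₂ , isC₁ , isC₂ , λ { refl → w∉ (x∈p∪q⁺ (inj₁ (x∈p∩q⁺ (w∈C₂ , w∈S)))) }

  ρ[C∪X]<ρ⊤ : 6 * k + 1 ≤ ρ H S → ∀ C → IsComponent H X C → ρ H (C ∪ X) < ρ H ⊤
  ρ[C∪X]<ρ⊤ 6k+1≤ρS C isC = begin-strict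
    ρ H (C ∪ X)         ≤⟨ ρ-subadditive C X ⟩
    ρ H C + ρ H X       ≤⟨ +-monoʳ-≤ (ρ H C) ρX≤k ⟩
    ρ H C + k           <⟨ +-monoʳ-< (ρ H C) k<ρR ⟩
    ρ H C + ρ H R       ≤⟨ ρ-superadditive (component-separated isC) ⟩
    ρ H (C ∪ R)         ≤⟨ ρ-mono (λ _ → ∈⊤) ⟩
    ρ H ⊤               ∎
    where
    open ≤-Reasoning
    R : V
    R = ∁ (C ∪ X)
    k<ρR : k < ρ H R
    k<ρR = ≰⇒> λ ρR≤k → m+1≤n⇒n≰m 6k+1≤ρS (<⇒≤ (begin-strict
      ρ H S              <⟨ ρS<3[k+ρR] isC (p⊆[q∩p]∪[r∪∁[q∪r]] S C X) ⟩
      3 * (k + ρ H R)    ≤⟨ *-monoʳ-≤ 3 (+-monoʳ-≤ k ρR≤k) ⟩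
      3 * (k + k)        ≡⟨ 3[k+k]≡6k k ⟩
      6 * k              ∎))

mainTheorem13 : (H : Hypergraph) (k : ℕ) → 1 ≤ k → (S X : Subset (n H))
    → BalancedSeparator H S X → ρ H X ≤ k
    → (3 * k + 1 ≤ ρ H S
    → Σ (Subset (n H)) (λ C₁ → Σ (Subset (n H)) (λ C₂ →
    IsComponent H X C₁ × IsComponent H X C₂ × C₁ ≢ C₂)))
    × (6 * k + 1 ≤ ρ H S
    → (C : Subset (n H)) → IsComponent H X C → ρ H (C ∪ X) < ρ H ⊤)
mainTheorem13 H k _ S X balanced ρX≤k =
  two-components H k S X balanced ρX≤k , ρ[C∪X]<ρ⊤ H k S X balanced ρX≤k
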